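{- Let $A$ be a finite alphabet of colors and $J$ a sentence over $A$. Then $\psi(E_J)=H_J$.
   Context: Words are finite sequences of colors; a sentence is a finite sequence $I=(w_1,\dots,w_k)$ of nonempty words; $|I|$ = number of letters, $w(I)=w_1\cdots w_k$, $\ell(I)=k$. $J\preceq I$ means $w(J)=w(I)$ and $I$ arises from $J$ by concatenating adjacent words. A sentence splits after its $i$-th letter if the $i$-th and $(i+1)$-th letters lie in different words; the complement $I^c$ is the unique sentence with $w(I^c)=w(I)$ splitting exactly at the positions where $I$ does not. $NSym_A$ is the free associative $\mathbb{Q}$-algebra on generators $H_w$ ($w$ nonempty words), $H_I=H_{w_1}\cdots H_{w_k}$. Colored ribbon functions: $R_I=\sum_{J\succeq I}(-1)^{\ell(J)-\ell(I)}H_J$ (a basis). Colored elementary functions: $E_I=\sum_{J\preceq I}(-1)^{|I|-\ell(J)}H_J$. $\psi:NSym_A\to NSym_A$ is the linear map with $\psi(R_I)=R_{I^c}$ for all sentences $I$. -}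

module Defs where

open import Data.Nat using (ℕ; zero; suc) renaming (_+_ to _+ℕ_)
open import Data.Nat.Properties using () renaming (_≟_ to _≟ℕ_)
open import Data.Bool using (Bool; true; false; not; if_then_else_)
open import Data.Fin using (Fin)
import Data.Fin.Properties as FinP
open import Data.List using (List; []; _∷_; _++_; map; concat; concatMap; length; replicate)
import Data.List.Properties as ListP
open import Data.Product using (_×_; _,_)
import Data.Product.Properties as ProdP
open import Data.Rational using (ℚ; 0ℚ; 1ℚ; _+_; _*_; -_)
open import Relation.Binary.Definitions using (DecidableEquality)
open import Relation.Binary.PropositionalEquality using (_≡_)
open import Relation.Nullary using (yes; no)

Word : ℕ → Set
Word n = Fin n × List (Fin n)

wordLetters : ∀ {n} → Word n → List (Fin n)
wordLetters (a , as) = a ∷ as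

_·w_ : ∀ {n} → Word n → Word n → Word n
(a , as) ·w v = (a , as ++ wordLetters v)

Sentence : ℕ → Set
Sentence n = List (Word n)

_≟S_ : ∀ {n} → DecidableEquality (Sentence n)
_≟S_ = ListP.≡-dec (ProdP.≡-dec FinP._≟_ (ListP.≡-dec FinP._≟_))

letters : ∀ {n} → Sentence n → List (Fin n)
letters I = concat (map wordLetters I)

size : ∀ {n} → Sentence n → ℕ
size I = length (letters I)

ℓ : ∀ {n} → Sentence n → ℕ
ℓ I = length I

-- All J with I ⪯ J (J obtained from I by concatenating adjacent words);
-- each such J is listed exactly once.
coarsenings : ∀ {n} → Sentence n → List (Sentence n)
coarsenings [] = [] ∷ []
coarsenings (w ∷ []) = (w ∷ []) ∷ []
coarsenings (w ∷ v ∷ I) = concatMap step (coarsenings (v ∷ I))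
  where
  step : _ → _
  step [] = []
  step (u ∷ K) = (w ∷ u ∷ K) ∷ ((w ·w u) ∷ K) ∷ []

splits' : ∀ {n} → Fin n → List (Fin n) → List (Sentence n)
splits' a [] = ((a , []) ∷ []) ∷ []
splits' a (b ∷ bs) = concatMap step (splits' b bs)
  where
  step : _ → _
  step [] = []
  step (u ∷ K) = ((a , []) ∷ u ∷ K) ∷ (((a , []) ·w u) ∷ K) ∷ []

splitsOfWord : ∀ {n} → Word n → List (Sentence n)
splitsOfWord (a , as) = splits' a as

-- All J with J ⪯ I (each listed exactly once).
refinements : ∀ {n} → Sentence n → List (Sentence n)
refinements [] = [] ∷ []
refinements (w ∷ I) =
  concatMap (λ S → map (λ T → S ++ T) (refinements I)) (splitsOfWord w)

dropLast : {A : Set} → List A → List A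
dropLast [] = []
dropLast (x ∷ []) = []
dropLast (x ∷ y ∷ xs) = x ∷ dropLast (y ∷ xs)

-- splitAt I : the i-th entry is true iff I splits after its i-th letter
-- (i = 1 .. |I| - 1).
splitPattern : ∀ {n} → Sentence n → List Bool
splitPattern I =
  dropLast (concat (map (λ { (a , as) → replicate (length as) false ++ (true ∷ []) }) I))

prependLetter : ∀ {n} → Fin n → Sentence n → Sentence n
prependLetter a [] = (a , []) ∷ []
prependLetter a ((x , xs) ∷ ws) = (a , x ∷ xs) ∷ ws

build : ∀ {n} → List (Fin n) → List Bool → Sentence n
build [] _ = []
build (a ∷ []) _ = (a , []) ∷ []
build (a ∷ b ∷ rest) (true ∷ bs) = (a , []) ∷ build (b ∷ rest) bs
build (a ∷ b ∷ rest) (false ∷ bs) = prependLetter a (build (b ∷ rest) bs)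
build (a ∷ b ∷ rest) [] = (a , []) ∷ build (b ∷ rest) []

_ᶜ : ∀ {n} → Sentence n → Sentence n
I ᶜ = build (letters I) (map not (splitPattern I))

-- NSym_A as the Q-vector space with basis { H_I : I sentence }
-- (free associative algebra on the H_w: monomials = sentences).
-- Elements are formal finite sums  Σ c_i H_{I_i}.

NSym : ℕ → Set
NSym n = List (ℚ × Sentence n)

coeff : ∀ {n} → Sentence n → NSym n → ℚ
coeff I [] = 0ℚ
coeff I ((c , J) ∷ xs) with I ≟S J
... | yes _ = c + coeff I xs
... | no _ = coeff I xs

_≈_ : ∀ {n} → NSym n → NSym n → Set
x ≈ y = ∀ I → coeff I x ≡ coeff I y

_⊕_ : ∀ {n} → NSym n → NSym n → NSym n
x ⊕ y = x ++ y

scale : ∀ {n} → ℚ → NSym n → NSym n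
scale c x = map (λ { (d , I) → (c * d , I) }) x

record IsLinear {n} (f : NSym n → NSym n) : Set where
  field
    resp  : ∀ {x y} → x ≈ y → f x ≈ f y
    add   : ∀ x y → f (x ⊕ y) ≈ (f x ⊕ f y)
    homog : ∀ c x → f (scale c x) ≈ scale c (f x)

sign : ℕ → ℚ
sign zero = 1ℚ
sign (suc k) = - sign k

H : ∀ {n} → Sentence n → NSym n
H I = (1ℚ , I) ∷ []

-- R_I = Σ_{J ⪰ I} (-1)^{ℓ(J)-ℓ(I)} H_J   (ℓ(J) ≤ ℓ(I), so sign by ℓ(I)+ℓ(J))
R : ∀ {n} → Sentence n → NSym n
R I = map (λ J → (sign (ℓ I +ℕ ℓ J) , J)) (coarsenings I)

-- E_I = Σ_{J ⪯ I} (-1)^{|I|-ℓ(J)} H_J   (ℓ(J) ≤ |I|, sign by |I|+ℓ(J))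
E : ∀ {n} → Sentence n → NSym n
E I = map (λ J → (sign (size I +ℕ ℓ J) , J)) (refinements I)

-- Every sentence arises from the empty one by repeatedly putting a letter in
-- front of it, either as a new one-letter word or glued to the first word,
-- and complementation exchanges these two moves.  Following how refinements,
-- coarsenings and the signs in R and E transform under the two moves, an
-- induction along this decomposition gives
--   E J = Σ_{I ⪯ Jᶜ} R I    and    H J = Σ_{I ⪯ Jᶜ} R (Iᶜ).
-- Applying ψ termwise to the first identity turns it into the second.

module Submission where

open import Defs
open import Data.Nat using (ℕ)

open import Algebra.Bundles using (CommutativeMonoid)
open import Data.Bool using (true; false; not)
open import Data.Fin using (Fin)
open import Data.List using (List; []; _∷_; _++_; map; concatMap)
import Data.List.Properties as List
open import Data.List.Relation.Unary.All using (All; []; _∷_; universal)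
open import Data.List.Relation.Unary.All.Properties using (concat⁺; gmap⁺; map⁺)
open import Data.Nat using (suc) renaming (_+_ to _+ℕ_)
import Data.Nat.Properties as ℕ
open import Data.Product using (_,_)
open import Data.Rational using (ℚ; 0ℚ; 1ℚ; _+_; _*_; -_; _-_)
open import Data.Rational.Properties
  using (+-0-commutativeMonoid; +-0-group; +-assoc; +-comm; +-identityˡ; +-identityʳ;
         neg-distrib-+; neg-distribˡ-*; *-identityˡ; *-identityʳ; *-zeroʳ)
open import Algebra.Properties.CommutativeSemigroup
  (CommutativeMonoid.commutativeSemigroup +-0-commutativeMonoid) using (interchange)
open import Algebra.Properties.Group +-0-group using (//-rightDividesˡ; ∙-cancelˡ; ⁻¹-involutive)
open import Function using (_∘_)
open import Level using (0ℓ)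
open import Relation.Binary.Bundles using (Setoid)
open import Relation.Binary.PropositionalEquality
open import Relation.Nullary using (yes; no)

∑ : {A : Set} → List A → (A → ℚ) → ℚ
∑ [] f = 0ℚ
∑ (x ∷ xs) f = f x + ∑ xs f

module _ {A : Set} where

  ∑-cong : ∀ xs {f g : A → ℚ} → (∀ x → f x ≡ g x) → ∑ xs f ≡ ∑ xs g
  ∑-cong [] eq = refl
  ∑-cong (x ∷ xs) eq = cong₂ _+_ (eq x) (∑-cong xs eq)

  ∑-cong-All : ∀ {P : A → Set} {xs} {f g : A → ℚ} →
               All P xs → (∀ {x} → P x → f x ≡ g x) → ∑ xs f ≡ ∑ xs g
  ∑-cong-All [] eq = refl
  ∑-cong-All (px ∷ pxs) eq = cong₂ _+_ (eq px) (∑-cong-All pxs eq)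

  ∑-++ : ∀ xs ys (f : A → ℚ) → ∑ (xs ++ ys) f ≡ ∑ xs f + ∑ ys f
  ∑-++ [] ys f = sym (+-identityˡ _)
  ∑-++ (x ∷ xs) ys f = trans (cong (f x +_) (∑-++ xs ys f)) (sym (+-assoc (f x) _ _))

  ∑-+ : ∀ xs (f g : A → ℚ) → ∑ xs (λ x → f x + g x) ≡ ∑ xs f + ∑ xs g
  ∑-+ [] f g = sym (+-identityʳ 0ℚ)
  ∑-+ (x ∷ xs) f g =
    trans (cong (f x + g x +_) (∑-+ xs f g)) (interchange (f x) (g x) (∑ xs f) (∑ xs g))

  ∑-neg : ∀ xs (f : A → ℚ) → ∑ xs (λ x → - f x) ≡ - ∑ xs f
  ∑-neg [] f = refl
  ∑-neg (x ∷ xs) f = trans (cong (- f x +_) (∑-neg xs f)) (sym (neg-distrib-+ (f x) _))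

  ∑-difference : ∀ xs (f g : A → ℚ) → ∑ xs (λ x → f x - g x) ≡ ∑ xs f - ∑ xs g
  ∑-difference xs f g = trans (∑-+ xs f (λ x → - g x)) (cong (∑ xs f +_) (∑-neg xs g))

module _ {A B : Set} where

  ∑-map : ∀ (h : A → B) xs (f : B → ℚ) → ∑ (map h xs) f ≡ ∑ xs (f ∘ h)
  ∑-map h [] f = refl
  ∑-map h (x ∷ xs) f = cong (f (h x) +_) (∑-map h xs f)

  ∑-concatMap : ∀ (h : A → List B) xs (f : B → ℚ) →
                ∑ (concatMap h xs) f ≡ ∑ xs (λ x → ∑ (h x) f)
  ∑-concatMap h [] f = refl
  ∑-concatMap h (x ∷ xs) f =
    trans (∑-++ (h x) (concatMap h xs) f) (cong (∑ (h x) f +_) (∑-concatMap h xs f))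

  concatMap-cong-All : ∀ {P : A → Set} {xs} {g h : A → List B} →
                       All P xs → (∀ {x} → P x → g x ≡ h x) → concatMap g xs ≡ concatMap h xs
  concatMap-cong-All [] eq = refl
  concatMap-cong-All (px ∷ pxs) eq = cong₂ _++_ (eq px) (concatMap-cong-All pxs eq)

sign-suc+suc : ∀ m k → sign (suc m +ℕ suc k) ≡ sign (m +ℕ k)
sign-suc+suc m k = trans (cong (-_ ∘ sign) (ℕ.+-suc m k)) (⁻¹-involutive (sign (m +ℕ k)))

module _ {n : ℕ} where

  data NonEmpty : Sentence n → Set where
    nonEmpty : ∀ {w I} → NonEmpty (w ∷ I)

  startWord : Fin n → Sentence n → Sentence n
  startWord a I = (a , []) ∷ I

  attach : Fin n → Sentence n → List (Sentence n)
  attach a S = startWord a S ∷ prependLetter a S ∷ []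

  ∑-concatMap-attach : ∀ a Ss (f : Sentence n → ℚ) →
    ∑ (concatMap (attach a) Ss) f ≡ ∑ Ss (λ S → f (startWord a S) + f (prependLetter a S))
  ∑-concatMap-attach a Ss f =
    trans (∑-concatMap (attach a) Ss f)
          (∑-cong Ss (λ S → cong (f (startWord a S) +_) (+-identityʳ _)))

  ᶜ-startWord : ∀ a {I} → NonEmpty I → startWord a I ᶜ ≡ prependLetter a (I ᶜ)
  ᶜ-startWord a {(b , []) ∷ I} nonEmpty = refl
  ᶜ-startWord a {(b , _ ∷ _) ∷ I} nonEmpty = refl

  ᶜ-prependLetter : ∀ a {I} → NonEmpty I → prependLetter a I ᶜ ≡ startWord a (I ᶜ)
  ᶜ-prependLetter a {(b , []) ∷ I} nonEmpty = refl
  ᶜ-prependLetter a {(b , _ ∷ _) ∷ I} nonEmpty = refl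

  prependLetter-nonEmpty : ∀ a I → NonEmpty (prependLetter a I)
  prependLetter-nonEmpty a [] = nonEmpty
  prependLetter-nonEmpty a (_ ∷ _) = nonEmpty

  build-nonEmpty : ∀ a as splitAt → NonEmpty (build (a ∷ as) splitAt)
  build-nonEmpty a [] splitAt = nonEmpty
  build-nonEmpty a (b ∷ bs) [] = nonEmpty
  build-nonEmpty a (b ∷ bs) (true ∷ splitAt) = nonEmpty
  build-nonEmpty a (b ∷ bs) (false ∷ splitAt) = prependLetter-nonEmpty a _

  ᶜ-nonEmpty : ∀ {I} → NonEmpty I → NonEmpty (I ᶜ)
  ᶜ-nonEmpty {(b , bs) ∷ I} nonEmpty =
    build-nonEmpty b (bs ++ letters I) (map not (splitPattern ((b , bs) ∷ I)))

  data View : Sentence n → Set where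
    empty  : View []
    single : ∀ a → View (startWord a [])
    start  : ∀ a {I} → NonEmpty I → View I → View (startWord a I)
    extend : ∀ a {I} → NonEmpty I → View I → View (prependLetter a I)

  view : ∀ I → View I
  view [] = empty
  view ((a , as) ∷ I) = view-∷ a as I
    where
    view-∷ : ∀ a as I → View ((a , as) ∷ I)
    view-∷ a [] [] = single a
    view-∷ a [] ((b , bs) ∷ I) = start a nonEmpty (view-∷ b bs I)
    view-∷ a (b ∷ bs) I = extend a nonEmpty (view-∷ b bs I)

  splits'-nonEmpty : ∀ a as → All NonEmpty (splits' a as)
  splits'-nonEmpty a [] = nonEmpty ∷ []
  splits'-nonEmpty a (b ∷ bs) =
    concat⁺ (gmap⁺ (λ { nonEmpty → nonEmpty ∷ nonEmpty ∷ [] }) (splits'-nonEmpty b bs))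

  refinements-nonEmpty : ∀ {I} → NonEmpty I → All NonEmpty (refinements I)
  refinements-nonEmpty {(a , as) ∷ I} nonEmpty =
    concat⁺ (gmap⁺ (λ { nonEmpty → map⁺ (universal (λ _ → nonEmpty) (refinements I)) })
                   (splits'-nonEmpty a as))

  coarsenings-nonEmpty : ∀ {I} → NonEmpty I → All NonEmpty (coarsenings I)
  coarsenings-nonEmpty {w ∷ []} nonEmpty = nonEmpty ∷ []
  coarsenings-nonEmpty {w ∷ v ∷ I} nonEmpty =
    concat⁺ (gmap⁺ (λ { nonEmpty → nonEmpty ∷ nonEmpty ∷ [] }) (coarsenings-nonEmpty {v ∷ I} nonEmpty))

  splits'-∷ : ∀ a b bs → splits' a (b ∷ bs) ≡ concatMap (attach a) (splits' b bs)
  splits'-∷ a b bs = concatMap-cong-All (splits'-nonEmpty b bs) λ { nonEmpty → refl }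

  coarsenings-startWord : ∀ a {I} → NonEmpty I →
    coarsenings (startWord a I) ≡ concatMap (attach a) (coarsenings I)
  coarsenings-startWord a {w ∷ I} nonEmpty =
    concatMap-cong-All (coarsenings-nonEmpty {w ∷ I} nonEmpty) λ { nonEmpty → refl }

  coarsenings-prependLetter : ∀ a {I} → NonEmpty I →
    coarsenings (prependLetter a I) ≡ map (prependLetter a) (coarsenings I)
  coarsenings-prependLetter a {w ∷ []} nonEmpty = refl
  coarsenings-prependLetter a {(b , bs) ∷ v ∷ I} nonEmpty =
    trans (concatMap-cong-All (coarsenings-nonEmpty {v ∷ I} nonEmpty) λ { nonEmpty → refl })
          (sym (List.map-concatMap (prependLetter a) _ (coarsenings (v ∷ I))))

  ∑-refinements-startWord : ∀ a I (f : Sentence n → ℚ) →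
    ∑ (refinements (startWord a I)) f ≡ ∑ (refinements I) (f ∘ startWord a)
  ∑-refinements-startWord a I f =
    trans (cong (λ Ms → ∑ Ms f) (List.++-identityʳ (map (startWord a) (refinements I))))
          (∑-map (startWord a) (refinements I) f)

  ∑-refinements-prependLetter : ∀ a {I} → NonEmpty I → ∀ (f : Sentence n → ℚ) →
    ∑ (refinements (prependLetter a I)) f ≡
      ∑ (refinements I) (f ∘ startWord a) + ∑ (refinements I) (f ∘ prependLetter a)
  ∑-refinements-prependLetter a {(b , bs) ∷ J} nonEmpty f = begin
    ∑ (concatMap follow (splits' a (b ∷ bs))) f
      ≡⟨ ∑-concatMap follow (splits' a (b ∷ bs)) f ⟩
    ∑ (splits' a (b ∷ bs)) (λ S → ∑ (follow S) f)
      ≡⟨ cong (λ Ts → ∑ Ts (λ S → ∑ (follow S) f)) (splits'-∷ a b bs) ⟩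
    ∑ (concatMap (attach a) Ss) (λ S → ∑ (follow S) f)
      ≡⟨ ∑-concatMap-attach a Ss (λ S → ∑ (follow S) f) ⟩
    ∑ Ss (λ S → ∑ (follow (startWord a S)) f + ∑ (follow (prependLetter a S)) f)
      ≡⟨ ∑-cong-All (splits'-nonEmpty b bs)
           (λ { nonEmpty → cong₂ _+_ (follow-∘ (startWord a) (λ _ → refl))
                                     (follow-∘ (prependLetter a) (λ _ → refl)) }) ⟩
    ∑ Ss (λ S → ∑ (follow S) (f ∘ startWord a) + ∑ (follow S) (f ∘ prependLetter a))
      ≡⟨ ∑-+ Ss _ _ ⟩
    ∑ Ss (λ S → ∑ (follow S) (f ∘ startWord a)) + ∑ Ss (λ S → ∑ (follow S) (f ∘ prependLetter a))
      ≡⟨ cong₂ _+_ (∑-concatMap follow Ss _) (∑-concatMap follow Ss _) ⟨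
    ∑ (concatMap follow Ss) (f ∘ startWord a) + ∑ (concatMap follow Ss) (f ∘ prependLetter a) ∎
    where
    open ≡-Reasoning
    Ss = splits' b bs
    follow : Sentence n → List (Sentence n)
    follow S = map (S ++_) (refinements J)
    follow-∘ : ∀ (h : Sentence n → Sentence n) {S} → (∀ T → h S ++ T ≡ h (S ++ T)) →
               ∑ (follow (h S)) f ≡ ∑ (follow S) (f ∘ h)
    follow-∘ h {S} eq =
      trans (∑-map (h S ++_) (refinements J) f)
            (trans (∑-cong (refinements J) (cong f ∘ eq)) (sym (∑-map (S ++_) (refinements J) (f ∘ h))))

  -- evalR f I and evalE f J are the images of R I and E J under the linear
  -- form sending each H M to f M.

  evalR : (Sentence n → ℚ) → Sentence n → ℚ
  evalR f I = ∑ (coarsenings I) (λ M → sign (ℓ I +ℕ ℓ M) * f M)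

  evalE : (Sentence n → ℚ) → Sentence n → ℚ
  evalE f J = ∑ (refinements J) (λ M → sign (size J +ℕ ℓ M) * f M)

  evalR-startWord : ∀ a {I} → NonEmpty I → ∀ f →
    evalR f (startWord a I) ≡ evalR (f ∘ startWord a) I - evalR (f ∘ prependLetter a) I
  evalR-startWord a {I} ne f = begin
    ∑ (coarsenings (startWord a I)) term
      ≡⟨ cong (λ Ms → ∑ Ms term) (coarsenings-startWord a ne) ⟩
    ∑ (concatMap (attach a) Ms) term
      ≡⟨ ∑-concatMap-attach a Ms term ⟩
    ∑ Ms (λ M → term (startWord a M) + term (prependLetter a M))
      ≡⟨ ∑-cong-All (coarsenings-nonEmpty ne)
           (λ { {M} nonEmpty → cong₂ _+_ (cong (_* f (startWord a M)) (sign-suc+suc (ℓ I) (ℓ M)))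
                                         (sym (neg-distribˡ-* (sign (ℓ I +ℕ ℓ M)) (f (prependLetter a M)))) }) ⟩
    ∑ Ms (λ M → sign (ℓ I +ℕ ℓ M) * f (startWord a M) - sign (ℓ I +ℕ ℓ M) * f (prependLetter a M))
      ≡⟨ ∑-difference Ms _ _ ⟩
    evalR (f ∘ startWord a) I - evalR (f ∘ prependLetter a) I ∎
    where
    open ≡-Reasoning
    Ms = coarsenings I
    term : Sentence n → ℚ
    term M = sign (suc (ℓ I) +ℕ ℓ M) * f M

  evalR-prependLetter : ∀ a {I} → NonEmpty I → ∀ f →
    evalR f (prependLetter a I) ≡ evalR (f ∘ prependLetter a) I
  evalR-prependLetter a {I@(_ ∷ _)} ne f =
    trans (cong (λ Ms → ∑ Ms term) (coarsenings-prependLetter a ne))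
          (trans (∑-map (prependLetter a) (coarsenings I) term)
                 (∑-cong-All (coarsenings-nonEmpty ne) λ { nonEmpty → refl }))
    where
    term : Sentence n → ℚ
    term M = sign (ℓ I +ℕ ℓ M) * f M

  evalR-ᶜ-startWord : ∀ a {I} → NonEmpty I → ∀ f →
    evalR f (startWord a I ᶜ) ≡ evalR (f ∘ prependLetter a) (I ᶜ)
  evalR-ᶜ-startWord a ne f =
    trans (cong (evalR f) (ᶜ-startWord a ne)) (evalR-prependLetter a (ᶜ-nonEmpty ne) f)

  evalR-ᶜ-prependLetter : ∀ a {I} → NonEmpty I → ∀ f →
    evalR f (prependLetter a I ᶜ) ≡
      evalR (f ∘ startWord a) (I ᶜ) - evalR (f ∘ prependLetter a) (I ᶜ)
  evalR-ᶜ-prependLetter a ne f =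
    trans (cong (evalR f) (ᶜ-prependLetter a ne)) (evalR-startWord a (ᶜ-nonEmpty ne) f)

  evalE-startWord : ∀ a I f → evalE f (startWord a I) ≡ evalE (f ∘ startWord a) I
  evalE-startWord a I f =
    trans (∑-refinements-startWord a I _)
          (∑-cong (refinements I) (λ M → cong (_* f (startWord a M)) (sign-suc+suc (size I) (ℓ M))))

  evalE-prependLetter : ∀ a {I} → NonEmpty I → ∀ f →
    evalE f (prependLetter a I) ≡ evalE (f ∘ startWord a) I - evalE (f ∘ prependLetter a) I
  evalE-prependLetter a {I@(_ ∷ _)} ne f = begin
    ∑ (refinements (prependLetter a I)) term
      ≡⟨ ∑-refinements-prependLetter a ne term ⟩
    ∑ Ms (term ∘ startWord a) + ∑ Ms (term ∘ prependLetter a)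
      ≡⟨ cong₂ _+_ (∑-cong Ms (λ M → cong (_* f (startWord a M)) (sign-suc+suc (size I) (ℓ M))))
                   (∑-cong-All (refinements-nonEmpty ne) λ { {M} nonEmpty →
                      sym (neg-distribˡ-* (sign (size I +ℕ ℓ M)) (f (prependLetter a M))) }) ⟩
    evalE (f ∘ startWord a) I + ∑ Ms (λ M → - (sign (size I +ℕ ℓ M) * f (prependLetter a M)))
      ≡⟨ cong (evalE (f ∘ startWord a) I +_) (∑-neg Ms _) ⟩
    evalE (f ∘ startWord a) I - evalE (f ∘ prependLetter a) I ∎
    where
    open ≡-Reasoning
    Ms = refinements I
    term : Sentence n → ℚ
    term M = sign (size (prependLetter a I) +ℕ ℓ M) * f M

  -- E J = Σ_{I ⪯ Jᶜ} R I
  ∑-evalR≡evalE : ∀ {J} → View J → ∀ f → ∑ (refinements (J ᶜ)) (evalR f) ≡ evalE f J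
  ∑-evalR≡evalE empty f = +-identityʳ _
  ∑-evalR≡evalE (single a) f = +-identityʳ _
  ∑-evalR≡evalE (start a {I} ne v) f = begin
    ∑ (refinements (startWord a I ᶜ)) (evalR f)
      ≡⟨ cong (λ K → ∑ (refinements K) (evalR f)) (ᶜ-startWord a ne) ⟩
    ∑ (refinements (prependLetter a (I ᶜ))) (evalR f)
      ≡⟨ ∑-refinements-prependLetter a (ᶜ-nonEmpty ne) (evalR f) ⟩
    ∑ Ss (evalR f ∘ startWord a) + ∑ Ss (evalR f ∘ prependLetter a)
      ≡⟨ cong₂ _+_ (trans (∑-cong-All Ss-nonEmpty (λ ne → evalR-startWord a ne f)) (∑-difference Ss _ _))
                   (∑-cong-All Ss-nonEmpty (λ ne → evalR-prependLetter a ne f)) ⟩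
    (∑ Ss (evalR (f ∘ startWord a)) - ∑ Ss (evalR (f ∘ prependLetter a)))
      + ∑ Ss (evalR (f ∘ prependLetter a))
      ≡⟨ //-rightDividesˡ _ _ ⟩
    ∑ Ss (evalR (f ∘ startWord a))
      ≡⟨ ∑-evalR≡evalE v (f ∘ startWord a) ⟩
    evalE (f ∘ startWord a) I
      ≡⟨ evalE-startWord a I f ⟨
    evalE f (startWord a I) ∎
    where
    open ≡-Reasoning
    Ss = refinements (I ᶜ)
    Ss-nonEmpty = refinements-nonEmpty (ᶜ-nonEmpty ne)
  ∑-evalR≡evalE (extend a {I} ne v) f = begin
    ∑ (refinements (prependLetter a I ᶜ)) (evalR f)
      ≡⟨ cong (λ K → ∑ (refinements K) (evalR f)) (ᶜ-prependLetter a ne) ⟩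
    ∑ (refinements (startWord a (I ᶜ))) (evalR f)
      ≡⟨ ∑-refinements-startWord a (I ᶜ) (evalR f) ⟩
    ∑ Ss (evalR f ∘ startWord a)
      ≡⟨ trans (∑-cong-All Ss-nonEmpty (λ ne → evalR-startWord a ne f)) (∑-difference Ss _ _) ⟩
    ∑ Ss (evalR (f ∘ startWord a)) - ∑ Ss (evalR (f ∘ prependLetter a))
      ≡⟨ cong₂ _-_ (∑-evalR≡evalE v (f ∘ startWord a)) (∑-evalR≡evalE v (f ∘ prependLetter a)) ⟩
    evalE (f ∘ startWord a) I - evalE (f ∘ prependLetter a) I
      ≡⟨ evalE-prependLetter a ne f ⟨
    evalE f (prependLetter a I) ∎
    where
    open ≡-Reasoning
    Ss = refinements (I ᶜ)
    Ss-nonEmpty = refinements-nonEmpty (ᶜ-nonEmpty ne)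

  -- H J = Σ_{I ⪯ Jᶜ} R (Iᶜ)
  ∑-evalR∘ᶜ≡eval : ∀ {J} → View J → ∀ f → ∑ (refinements (J ᶜ)) (evalR f ∘ _ᶜ) ≡ f J
  ∑-evalR∘ᶜ≡eval empty f = trans (+-identityʳ _) (trans (+-identityʳ _) (*-identityˡ _))
  ∑-evalR∘ᶜ≡eval (single a) f = trans (+-identityʳ _) (trans (+-identityʳ _) (*-identityˡ _))
  ∑-evalR∘ᶜ≡eval (start a {I} ne v) f = begin
    ∑ (refinements (startWord a I ᶜ)) (evalR f ∘ _ᶜ)
      ≡⟨ cong (λ K → ∑ (refinements K) (evalR f ∘ _ᶜ)) (ᶜ-startWord a ne) ⟩
    ∑ (refinements (prependLetter a (I ᶜ))) (evalR f ∘ _ᶜ)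
      ≡⟨ ∑-refinements-prependLetter a (ᶜ-nonEmpty ne) (evalR f ∘ _ᶜ) ⟩
    ∑ Ss (evalR f ∘ _ᶜ ∘ startWord a) + ∑ Ss (evalR f ∘ _ᶜ ∘ prependLetter a)
      ≡⟨ cong₂ _+_ (∑-cong-All Ss-nonEmpty (λ ne → evalR-ᶜ-startWord a ne f))
                   (trans (∑-cong-All Ss-nonEmpty (λ ne → evalR-ᶜ-prependLetter a ne f)) (∑-difference Ss _ _)) ⟩
    ∑ Ss (evalR (f ∘ prependLetter a) ∘ _ᶜ)
      + (∑ Ss (evalR (f ∘ startWord a) ∘ _ᶜ) - ∑ Ss (evalR (f ∘ prependLetter a) ∘ _ᶜ))
      ≡⟨ trans (+-comm (∑ Ss (evalR (f ∘ prependLetter a) ∘ _ᶜ)) _) (//-rightDividesˡ _ _) ⟩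
    ∑ Ss (evalR (f ∘ startWord a) ∘ _ᶜ)
      ≡⟨ ∑-evalR∘ᶜ≡eval v (f ∘ startWord a) ⟩
    f (startWord a I) ∎
    where
    open ≡-Reasoning
    Ss = refinements (I ᶜ)
    Ss-nonEmpty = refinements-nonEmpty (ᶜ-nonEmpty ne)
  ∑-evalR∘ᶜ≡eval (extend a {I} ne v) f = begin
    ∑ (refinements (prependLetter a I ᶜ)) (evalR f ∘ _ᶜ)
      ≡⟨ cong (λ K → ∑ (refinements K) (evalR f ∘ _ᶜ)) (ᶜ-prependLetter a ne) ⟩
    ∑ (refinements (startWord a (I ᶜ))) (evalR f ∘ _ᶜ)
      ≡⟨ ∑-refinements-startWord a (I ᶜ) (evalR f ∘ _ᶜ) ⟩
    ∑ (refinements (I ᶜ)) (evalR f ∘ _ᶜ ∘ startWord a)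
      ≡⟨ ∑-cong-All (refinements-nonEmpty (ᶜ-nonEmpty ne)) (λ ne → evalR-ᶜ-startWord a ne f) ⟩
    ∑ (refinements (I ᶜ)) (evalR (f ∘ prependLetter a) ∘ _ᶜ)
      ≡⟨ ∑-evalR∘ᶜ≡eval v (f ∘ prependLetter a) ⟩
    f (prependLetter a I) ∎
    where open ≡-Reasoning

  ≈-setoid : Setoid 0ℓ 0ℓ
  ≈-setoid = record
    { Carrier = NSym n
    ; _≈_ = _≈_
    ; isEquivalence = record
      { refl = λ _ → refl
      ; sym = λ x≈y I → sym (x≈y I)
      ; trans = λ x≈y y≈z I → trans (x≈y I) (y≈z I)
      }
    }

  coeff-++ : ∀ K (x y : NSym n) → coeff K (x ++ y) ≡ coeff K x + coeff K y
  coeff-++ K [] y = sym (+-identityˡ _)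
  coeff-++ K ((c , J) ∷ x) y with K ≟S J
  ... | yes _ = trans (cong (c +_) (coeff-++ K x y)) (sym (+-assoc c _ _))
  ... | no _ = coeff-++ K x y

  coeff-concatMap : ∀ {A : Set} K (h : A → NSym n) xs → coeff K (concatMap h xs) ≡ ∑ xs (coeff K ∘ h)
  coeff-concatMap K h [] = refl
  coeff-concatMap K h (x ∷ xs) =
    trans (coeff-++ K (h x) _) (cong (coeff K (h x) +_) (coeff-concatMap K h xs))

  δ : Sentence n → Sentence n → ℚ
  δ K M = coeff K (H M)

  coeff-singleton : ∀ K c M → coeff K ((c , M) ∷ []) ≡ c * δ K M
  coeff-singleton K c M with K ≟S M
  ... | yes _ = trans (+-identityʳ c) (sym (trans (cong (c *_) (+-identityʳ 1ℚ)) (*-identityʳ c)))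
  ... | no _ = sym (*-zeroʳ c)

  coeff-weighted : ∀ K (g : Sentence n → ℚ) Ms →
    coeff K (map (λ M → (g M , M)) Ms) ≡ ∑ Ms (λ M → g M * δ K M)
  coeff-weighted K g [] = refl
  coeff-weighted K g (M ∷ Ms) =
    trans (coeff-++ K ((g M , M) ∷ []) _)
          (cong₂ _+_ (coeff-singleton K (g M) M) (coeff-weighted K g Ms))

  concatMap-cong-≈ : ∀ {A : Set} {g h : A → NSym n} xs → (∀ x → g x ≈ h x) →
                     concatMap g xs ≈ concatMap h xs
  concatMap-cong-≈ {g = g} {h} xs eq K =
    trans (coeff-concatMap K g xs) (trans (∑-cong xs (λ x → eq x K)) (sym (coeff-concatMap K h xs)))

  E≈concatMap-R : ∀ J → E J ≈ concatMap R (refinements (J ᶜ))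
  E≈concatMap-R J K = begin
    coeff K (E J)
      ≡⟨ coeff-weighted K _ (refinements J) ⟩
    evalE (δ K) J
      ≡⟨ ∑-evalR≡evalE (view J) (δ K) ⟨
    ∑ Is (evalR (δ K))
      ≡⟨ ∑-cong Is (λ I → coeff-weighted K _ (coarsenings I)) ⟨
    ∑ Is (coeff K ∘ R)
      ≡⟨ coeff-concatMap K R Is ⟨
    coeff K (concatMap R Is) ∎
    where
    open ≡-Reasoning
    Is = refinements (J ᶜ)

  H≈concatMap-Rᶜ : ∀ J → H J ≈ concatMap (R ∘ _ᶜ) (refinements (J ᶜ))
  H≈concatMap-Rᶜ J K = begin
    δ K J
      ≡⟨ ∑-evalR∘ᶜ≡eval (view J) (δ K) ⟨
    ∑ Is (evalR (δ K) ∘ _ᶜ)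
      ≡⟨ ∑-cong Is (λ I → coeff-weighted K _ (coarsenings (I ᶜ))) ⟨
    ∑ Is (coeff K ∘ R ∘ _ᶜ)
      ≡⟨ coeff-concatMap K (R ∘ _ᶜ) Is ⟨
    coeff K (concatMap (R ∘ _ᶜ) Is) ∎
    where
    open ≡-Reasoning
    Is = refinements (J ᶜ)

  module _ {f : NSym n → NSym n} (linear : IsLinear f) where
    open IsLinear linear

    linear-[] : f [] ≈ []
    linear-[] K = ∙-cancelˡ c c 0ℚ (trans (sym (trans (add [] [] K) (coeff-++ K (f []) (f []))))
                                          (sym (+-identityʳ c)))
      where c = coeff K (f [])

    linear-concatMap : ∀ {A : Set} (h : A → NSym n) xs → f (concatMap h xs) ≈ concatMap (f ∘ h) xs
    linear-concatMap h [] = linear-[]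
    linear-concatMap h (x ∷ xs) K =
      trans (add (h x) (concatMap h xs) K)
            (trans (coeff-++ K (f (h x)) _)
                   (trans (cong (coeff K (f (h x)) +_) (linear-concatMap h xs K))
                          (sym (coeff-++ K (f (h x)) _))))

proposition7p16 : (n : ℕ) (ψ : NSym n → NSym n) → IsLinear ψ →
    (∀ (I : Sentence n) → ψ (R I) ≈ R (I ᶜ)) →
    ∀ (J : Sentence n) → ψ (E J) ≈ H J
proposition7p16 n ψ linear ψ-R J = begin
  ψ (E J)                       ≈⟨ IsLinear.resp linear (E≈concatMap-R J) ⟩
  ψ (concatMap R Is)            ≈⟨ linear-concatMap linear R Is ⟩
  concatMap (ψ ∘ R) Is          ≈⟨ concatMap-cong-≈ Is ψ-R ⟩
  concatMap (R ∘ _ᶜ) Is         ≈⟨ H≈concatMap-Rᶜ J ⟨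
  H J                           ∎
  where
  open import Relation.Binary.Reasoning.Setoid ≈-setoid
  Is = refinements (J ᶜ)
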